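{- Let $G$ be a simple graph with $n$ vertices, adjacency matrix $A$, and diagonal degree matrix $D$. Then \[\alpha(G)=\max\{\mathbf{e}^\top x \mid x\in\{0,1\}^n,\ 0\leq (A+I)x-\mathbf{e}\leq (D-I)(\mathbf{e}-x)\}.\]
   Context: $I$ is the $n\times n$ identity matrix, $\mathbf{e}$ the all-ones vector, inequalities componentwise; $\alpha(G)$ is the maximum cardinality of an independent set of $G$. -}

module Defs where

open import Data.Nat using (ℕ; zero; suc)
open import Data.Integer using (ℤ; +_; _+_; _-_; _*_; _≤_)
open import Data.Bool using (Bool; true; false; if_then_else_)
open import Data.Fin using (Fin; zero; suc; _≟_)
open import Data.Fin.Subset using (Subset; _∈_; ∣_∣)
open import Data.Product using (Σ; _×_)
open import Relation.Binary.PropositionalEquality using (_≡_)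
open import Relation.Nullary.Decidable using (⌊_⌋)

record SimpleGraph (n : ℕ) : Set where
  field
    adj       : Fin n → Fin n → Bool
    symmetric : ∀ i j → adj i j ≡ adj j i
    loopless  : ∀ i → adj i i ≡ false
open SimpleGraph public

Matrix : ℕ → Set
Matrix n = Fin n → Fin n → ℤ

Vector : ℕ → Set
Vector n = Fin n → ℤ

∑ : ∀ {n} → (Fin n → ℤ) → ℤ
∑ {zero}  f = + 0
∑ {suc n} f = f zero + ∑ (λ i → f (suc i))

b2z : Bool → ℤ
b2z true  = + 1
b2z false = + 0

adjMatrix : ∀ {n} → SimpleGraph n → Matrix n
adjMatrix G i j = b2z (adj G i j)

idMatrix : ∀ {n} → Matrix n
idMatrix i j = b2z ⌊ i ≟ j ⌋

degree : ∀ {n} → SimpleGraph n → Fin n → ℤ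
degree G i = ∑ (λ j → adjMatrix G i j)

degMatrix : ∀ {n} → SimpleGraph n → Matrix n
degMatrix G i j = degree G i * idMatrix i j

_⊕_ : ∀ {n} → Matrix n → Matrix n → Matrix n
(M ⊕ N) i j = M i j + N i j

_⊖_ : ∀ {n} → Matrix n → Matrix n → Matrix n
(M ⊖ N) i j = M i j - N i j

_·_ : ∀ {n} → Matrix n → Vector n → Vector n
(M · x) i = ∑ (λ j → M i j * x j)

ones : ∀ {n} → Vector n
ones _ = + 1

dotOnes : ∀ {n} → Vector n → ℤ
dotOnes x = ∑ x

toVec : ∀ {n} → (Fin n → Bool) → Vector n
toVec x i = b2z (x i)

IsIndependent : ∀ {n} → SimpleGraph n → Subset n → Set
IsIndependent G S = ∀ i j → i ∈ S → j ∈ S → adj G i j ≡ false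

IsIndependenceNumber : ∀ {n} → SimpleGraph n → ℕ → Set
IsIndependenceNumber {n} G m =
  Σ (Subset n) (λ S → IsIndependent G S × ∣ S ∣ ≡ m)
  × (∀ (S : Subset n) → IsIndependent G S → ∣ S ∣ Data.Nat.≤ m)

Feasible : ∀ {n} → SimpleGraph n → (Fin n → Bool) → Set
Feasible G x =
  ∀ i → (+ 0 ≤ ((adjMatrix G ⊕ idMatrix) · toVec x) i - ones i)
      × (((adjMatrix G ⊕ idMatrix) · toVec x) i - ones i
           ≤ ((degMatrix G ⊖ idMatrix) · (λ j → ones j - toVec x j)) i)

IsFeasibleMax : ∀ {n} → SimpleGraph n → ℤ → Set
IsFeasibleMax {n} G m =
  Σ (Fin n → Bool) (λ x → Feasible G x × dotOnes (toVec x) ≡ m)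
  × (∀ (x : Fin n → Bool) → Feasible G x → dotOnes (toVec x) ≤ m)

-- A 0/1 vector x is feasible exactly when it is the indicator of a maximal
-- independent set.  Writing k for the number of neighbours of i in x and d for
-- the degree of i, row i of the constraints reads 0 ≤ k ≤ 0 when x i = 1 and
-- 1 ≤ k ≤ d when x i = 0: members of x have no neighbour in x (independence)
-- and every non-member has one (maximality; k ≤ d holds anyway).  So every
-- feasible x is independent, and a maximum independent set is feasible.
module Submission where

open import Defs
open import Data.Nat using (ℕ)
open import Data.Integer using (+_)
open import Data.Product using (Σ; _×_)

open import Data.Bool using (Bool; true; false; _∧_)
open import Data.Bool.Properties using (∧-identityʳ; ∧-zeroʳ) renaming (_≟_ to _≟ᵇ_)
open import Data.Empty using (⊥-elim)
open import Data.Fin using (Fin; zero; suc; _≟_)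
open import Data.Fin.Properties using (all?)
open import Data.Fin.Subset using (Subset; ∣_∣; _∈_; _∉_; _∪_; ⁅_⁆) renaming (⊥ to ∅)
open import Data.Fin.Subset.Properties
  using (_∈?_; ∉⊥; x∈⁅x⁆; x∈⁅y⁆⇒x≡y; x∈p∪q⁺; x∈p∪q⁻; p⊆p∪q; p⊂q⇒∣p∣<∣q∣)
open import Data.Integer using (ℤ; _-_; _*_; -_; +≤+) renaming (_+_ to _+ℤ_; _≤_ to _≤ℤ_)
open import Data.Integer.Properties
  using (+-identityˡ; +-identityʳ; *-identityˡ; *-identityʳ; *-zeroˡ; *-zeroʳ;
         *-distribʳ-+; drop‿+≤+; i≤j⇒0≤j-i; +-monoˡ-≤)
open import Data.Integer.Tactic.RingSolver using (solve-∀)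
open import Data.Nat using (_+_; _≤_; _<_; z≤n; s≤s)
open import Data.Nat.Properties
  using (≤-refl; ≤-trans; ≤-total; <⇒≱; +-mono-≤; n≤0⇒n≡0; m+n≡0⇒m≡0; m+n≡0⇒n≡0)
open import Data.Product using (_,_; ∃)
open import Data.Sum using (_⊎_; inj₁; inj₂; map₂)
open import Data.Vec using (_∷_; []; lookup; tabulate)
open import Data.Vec.Properties using ([]=⇒lookup; lookup⇒[]=; lookup∘tabulate; tabulate∘lookup)
open import Level using (0ℓ)
open import Relation.Nullary using (¬_; yes; no)
open import Relation.Nullary.Decidable using (_→-dec_)
open import Relation.Unary using (Pred; Decidable)
open import Relation.Binary.PropositionalEquality

private
  variable
    n : ℕ

∧-true⇒false : ∀ {a b} → a ∧ b ≡ false → b ≡ true → a ≡ false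
∧-true⇒false {a} a∧b≡false refl = trans (sym (∧-identityʳ a)) a∧b≡false

lookup≡false⇒∉ : {p : Subset n} {x : Fin n} → lookup p x ≡ false → x ∉ p
lookup≡false⇒∉ x∉p x∈p with trans (sym ([]=⇒lookup x∈p)) x∉p
... | ()

∈-tabulate⁻ : {c : Fin n → Bool} {i : Fin n} → i ∈ tabulate c → c i ≡ true
∈-tabulate⁻ {c = c} {i} i∈c = trans (sym (lookup∘tabulate c i)) ([]=⇒lookup i∈c)

∈∪⁅⁆⁻ : {p : Subset n} {x y : Fin n} → y ∈ p ∪ ⁅ x ⁆ → y ∈ p ⊎ y ≡ x
∈∪⁅⁆⁻ {p = p} {x} y∈ = map₂ (x∈⁅y⁆⇒x≡y x) (x∈p∪q⁻ p ⁅ x ⁆ y∈)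

bit : Bool → ℕ
bit true  = 1
bit false = 0

count : (Fin n → Bool) → ℕ
count {ℕ.zero}  c = 0
count {ℕ.suc n} c = bit (c zero) + count (λ j → c (suc j))

count≡∣tabulate∣ : (c : Fin n → Bool) → count c ≡ ∣ tabulate c ∣
count≡∣tabulate∣ {ℕ.zero}  c = refl
count≡∣tabulate∣ {ℕ.suc n} c with c zero
... | true  = cong ℕ.suc (count≡∣tabulate∣ (λ j → c (suc j)))
... | false = count≡∣tabulate∣ (λ j → c (suc j))

count≡0⇒false : (c : Fin n → Bool) → count c ≡ 0 → ∀ j → c j ≡ false
count≡0⇒false c c≡0 zero with c zero | m+n≡0⇒m≡0 (bit (c zero)) c≡0
... | false | _ = refl
count≡0⇒false c c≡0 (suc j) =
  count≡0⇒false (λ k → c (suc k)) (m+n≡0⇒n≡0 (bit (c zero)) c≡0) j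

false⇒count≡0 : (c : Fin n → Bool) → (∀ j → c j ≡ false) → count c ≡ 0
false⇒count≡0 {ℕ.zero}  c _ = refl
false⇒count≡0 {ℕ.suc n} c c≡false =
  cong₂ _+_ (cong bit (c≡false zero)) (false⇒count≡0 (λ j → c (suc j)) (λ j → c≡false (suc j)))

count-∧-≤ : (c d : Fin n → Bool) → count (λ j → c j ∧ d j) ≤ count c
count-∧-≤ {ℕ.zero}  c d = z≤n
count-∧-≤ {ℕ.suc n} c d =
  +-mono-≤ (bit-∧ (c zero) (d zero)) (count-∧-≤ (λ j → c (suc j)) (λ j → d (suc j)))
  where
    bit-∧ : ∀ a b → bit (a ∧ b) ≤ bit a
    bit-∧ true  true  = ≤-refl
    bit-∧ true  false = z≤n
    bit-∧ false _     = z≤n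

∑-cong : {f g : Fin n → ℤ} → (∀ i → f i ≡ g i) → ∑ f ≡ ∑ g
∑-cong {ℕ.zero}  f≡g = refl
∑-cong {ℕ.suc n} f≡g = cong₂ _+ℤ_ (f≡g zero) (∑-cong (λ i → f≡g (suc i)))

∑-+ : (f g : Fin n → ℤ) → ∑ (λ i → f i +ℤ g i) ≡ ∑ f +ℤ ∑ g
∑-+ {ℕ.zero}  f g = refl
∑-+ {ℕ.suc n} f g = begin
  (f zero +ℤ g zero) +ℤ ∑ (λ i → f (suc i) +ℤ g (suc i))
    ≡⟨ cong ((f zero +ℤ g zero) +ℤ_) (∑-+ (λ i → f (suc i)) (λ i → g (suc i))) ⟩
  (f zero +ℤ g zero) +ℤ (∑ (λ i → f (suc i)) +ℤ ∑ (λ i → g (suc i)))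
    ≡⟨ middle-swap (f zero) (g zero) _ _ ⟩
  (f zero +ℤ ∑ (λ i → f (suc i))) +ℤ (g zero +ℤ ∑ (λ i → g (suc i))) ∎
  where
    open ≡-Reasoning
    middle-swap : ∀ a b c d → (a +ℤ b) +ℤ (c +ℤ d) ≡ (a +ℤ c) +ℤ (b +ℤ d)
    middle-swap = solve-∀

∑-b2z : (c : Fin n → Bool) → ∑ (λ j → b2z (c j)) ≡ + count c
∑-b2z {ℕ.zero}  c = refl
∑-b2z {ℕ.suc n} c = cong₂ _+ℤ_ (b2z≡bit (c zero)) (∑-b2z (λ j → c (suc j)))
  where
    b2z≡bit : ∀ b → b2z b ≡ + bit b
    b2z≡bit true  = refl
    b2z≡bit false = refl

∑-zero : {f : Fin n → ℤ} → (∀ i → f i ≡ + 0) → ∑ f ≡ + 0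
∑-zero {ℕ.zero}  f≡0 = refl
∑-zero {ℕ.suc n} f≡0 = cong₂ _+ℤ_ (f≡0 zero) (∑-zero (λ i → f≡0 (suc i)))

idMatrix-suc : (i j : Fin n) → idMatrix (suc i) (suc j) ≡ idMatrix i j
idMatrix-suc i j with i ≟ j
... | yes _ = refl
... | no _  = refl

idMatrix-· : (v : Vector n) (i : Fin n) → (idMatrix · v) i ≡ v i
idMatrix-· v zero =
  trans (cong₂ _+ℤ_ (*-identityˡ (v zero)) (∑-zero (λ j → *-zeroˡ (v (suc j)))))
        (+-identityʳ (v zero))
idMatrix-· {ℕ.suc n} v (suc i) =
  trans (cong₂ _+ℤ_ (*-zeroˡ (v zero)) shifted) (+-identityˡ (v (suc i)))
  where
    shifted : ∑ (λ j → idMatrix (suc i) (suc j) * v (suc j)) ≡ v (suc i)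
    shifted = trans (∑-cong (λ j → cong (_* v (suc j)) (idMatrix-suc i j)))
                    (idMatrix-· (λ j → v (suc j)) i)

Largest : Pred (Subset n) 0ℓ → Subset n → Set
Largest P S = P S × (∀ T → P T → ∣ T ∣ ≤ ∣ S ∣)

largest? : {P : Pred (Subset n) 0ℓ} → Decidable P → (∀ S → ¬ P S) ⊎ ∃ (Largest P)
largest? {ℕ.zero} P? with P? []
... | yes p = inj₂ ([] , p , λ { [] _ → z≤n })
... | no ¬p = inj₁ λ { [] → ¬p }
largest? {ℕ.suc n} P? with largest? (λ v → P? (false ∷ v)) | largest? (λ v → P? (true ∷ v))
... | inj₁ ¬P₀ | inj₁ ¬P₁ = inj₁ λ { (false ∷ v) → ¬P₀ v ; (true ∷ v) → ¬P₁ v }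
... | inj₂ (v , p , max) | inj₁ ¬P₁ =
  inj₂ (false ∷ v , p , λ { (false ∷ w) q → max w q ; (true ∷ w) q → ⊥-elim (¬P₁ w q) })
... | inj₁ ¬P₀ | inj₂ (v , p , max) =
  inj₂ (true ∷ v , p , λ { (false ∷ w) q → ⊥-elim (¬P₀ w q) ; (true ∷ w) q → s≤s (max w q) })
... | inj₂ (v₀ , p₀ , max₀) | inj₂ (v₁ , p₁ , max₁) with ≤-total (ℕ.suc ∣ v₁ ∣) ∣ v₀ ∣
...   | inj₁ v₁<v₀ = inj₂ (false ∷ v₀ , p₀ , λ { (false ∷ w) q → max₀ w q
                                              ; (true ∷ w) q → ≤-trans (s≤s (max₁ w q)) v₁<v₀ })
...   | inj₂ v₀≤v₁ = inj₂ (true ∷ v₁ , p₁ , λ { (false ∷ w) q → ≤-trans (max₀ w q) v₀≤v₁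
                                             ; (true ∷ w) q → s≤s (max₁ w q) })

largest : {P : Pred (Subset n) 0ℓ} → Decidable P → ∀ {S} → P S → ∃ (Largest P)
largest P? {S} p with largest? P?
... | inj₁ ¬P = ⊥-elim (¬P S p)
... | inj₂ L  = L

∣p∣<∣p∪⁅x⁆∣ : {p : Subset n} {x : Fin n} → x ∉ p → ∣ p ∣ < ∣ p ∪ ⁅ x ⁆ ∣
∣p∣<∣p∪⁅x⁆∣ {p = p} {x} x∉p = p⊂q⇒∣p∣<∣q∣ (p⊆p∪q ⁅ x ⁆ , x , x∈p∪q⁺ (inj₂ (x∈⁅x⁆ x)) , x∉p)

Sandwiched : ℤ → ℤ → Set
Sandwiched a b = + 0 ≤ℤ a × a ≤ℤ b

-- Row i of the constraints when i has k neighbours in x, degree d and x i = b.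
Row : ℕ → ℕ → Bool → Set
Row k d b = Sandwiched ((+ k +ℤ b2z b) - + 1) ((+ d - + 1) * (+ 1 - b2z b))

Row-true⇒ : ∀ {k d} → Row k d true → k ≡ 0
Row-true⇒ {k} {d} (_ , upper) =
  n≤0⇒n≡0 (drop‿+≤+ (subst₂ _≤ℤ_ (+1-1 (+ k)) (*-zeroʳ (+ d - + 1)) upper))
  where
    +1-1 : ∀ a → (a +ℤ + 1) - + 1 ≡ a
    +1-1 = solve-∀

Row-true : ∀ d → Row 0 d true
Row-true d = +≤+ z≤n , subst (+ 0 ≤ℤ_) (sym (*-zeroʳ (+ d - + 1))) (+≤+ z≤n)

Row-false : ∀ {k d} → 1 ≤ k → k ≤ d → Row k d false
Row-false {k} {d} 1≤k k≤d =
  subst₂ Sandwiched (cong (_- + 1) (sym (+-identityʳ (+ k)))) (sym (*-identityʳ (+ d - + 1)))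
         (i≤j⇒0≤j-i (+≤+ 1≤k) , +-monoˡ-≤ (- + 1) (+≤+ k≤d))

module _ (G : SimpleGraph n) where

  adjacentIn : (Fin n → Bool) → Fin n → Fin n → Bool
  adjacentIn x i j = adj G i j ∧ x j

  module _ (x : Fin n → Bool) (i : Fin n) where

    constraint-lhs : ((adjMatrix G ⊕ idMatrix) · toVec x) i - ones i
                   ≡ (+ count (adjacentIn x i) +ℤ b2z (x i)) - + 1
    constraint-lhs = cong (_- + 1) (begin
      ∑ (λ j → (adjMatrix G i j +ℤ idMatrix i j) * toVec x j)
        ≡⟨ ∑-cong (λ j → *-distribʳ-+ (toVec x j) (adjMatrix G i j) (idMatrix i j)) ⟩
      ∑ (λ j → adjMatrix G i j * toVec x j +ℤ idMatrix i j * toVec x j)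
        ≡⟨ ∑-+ (λ j → adjMatrix G i j * toVec x j) (λ j → idMatrix i j * toVec x j) ⟩
      ∑ (λ j → adjMatrix G i j * toVec x j) +ℤ (idMatrix · toVec x) i
        ≡⟨ cong₂ _+ℤ_ (trans (∑-cong (λ j → b2z-∧ (adj G i j) (x j))) (∑-b2z (adjacentIn x i)))
                      (idMatrix-· (toVec x) i) ⟩
      + count (adjacentIn x i) +ℤ b2z (x i) ∎)
      where
        open ≡-Reasoning
        b2z-∧ : ∀ a b → b2z a * b2z b ≡ b2z (a ∧ b)
        b2z-∧ true  true  = refl
        b2z-∧ true  false = refl
        b2z-∧ false _     = refl

    constraint-rhs : ((degMatrix G ⊖ idMatrix) · (λ j → ones j - toVec x j)) i
                   ≡ (+ count (adj G i) - + 1) * (+ 1 - b2z (x i))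
    constraint-rhs = begin
      ∑ (λ j → (degree G i * idMatrix i j - idMatrix i j) * y j)
        ≡⟨ ∑-cong (λ j → factor (degree G i) (idMatrix i j) (y j)) ⟩
      (idMatrix · (λ j → (degree G i - + 1) * y j)) i
        ≡⟨ idMatrix-· (λ j → (degree G i - + 1) * y j) i ⟩
      (degree G i - + 1) * y i
        ≡⟨ cong (λ d → (d - + 1) * y i) (∑-b2z (adj G i)) ⟩
      (+ count (adj G i) - + 1) * y i ∎
      where
        open ≡-Reasoning
        y : Vector n
        y j = ones j - toVec x j
        factor : ∀ d δ v → (d * δ - δ) * v ≡ δ * ((d - + 1) * v)
        factor = solve-∀

  feasible⇒rows : ∀ {x} → Feasible G x → ∀ i → Row (count (adjacentIn x i)) (count (adj G i)) (x i)
  feasible⇒rows {x} feasible i = subst₂ Sandwiched (constraint-lhs x i) (constraint-rhs x i) (feasible i)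

  rows⇒feasible : ∀ {x} → (∀ i → Row (count (adjacentIn x i)) (count (adj G i)) (x i)) → Feasible G x
  rows⇒feasible {x} rows i = subst₂ Sandwiched (sym (constraint-lhs x i)) (sym (constraint-rhs x i)) (rows i)

  feasible⇒independent : ∀ {x} → Feasible G x → IsIndependent G (tabulate x)
  feasible⇒independent {x} feasible i j i∈x j∈x =
    ∧-true⇒false (count≡0⇒false (adjacentIn x i) isolated j) (∈-tabulate⁻ j∈x)
    where
      isolated : count (adjacentIn x i) ≡ 0
      isolated = Row-true⇒ {d = count (adj G i)}
        (subst (Row (count (adjacentIn x i)) (count (adj G i))) (∈-tabulate⁻ i∈x) (feasible⇒rows feasible i))

  independent-∪⁅⁆ : ∀ {S i} → IsIndependent G S → (∀ j → j ∈ S → adj G i j ≡ false) →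
                    IsIndependent G (S ∪ ⁅ i ⁆)
  independent-∪⁅⁆ {S} {i} independent i≁S j k j∈ k∈ with ∈∪⁅⁆⁻ j∈ | ∈∪⁅⁆⁻ k∈
  ... | inj₁ j∈S  | inj₁ k∈S  = independent j k j∈S k∈S
  ... | inj₁ j∈S  | inj₂ refl = trans (symmetric G j i) (i≁S j j∈S)
  ... | inj₂ refl | inj₁ k∈S  = i≁S k k∈S
  ... | inj₂ refl | inj₂ refl = loopless G i

  largest-independent⇒feasible : ∀ {S} → Largest (IsIndependent G) S → Feasible G (lookup S)
  largest-independent⇒feasible {S} (independent , maximum) = rows⇒feasible row
    where
      isolated : ∀ {i} → i ∈ S → ∀ j → adjacentIn (lookup S) i j ≡ false
      isolated {i} i∈S j with lookup S j in j∈S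
      ... | false = ∧-zeroʳ (adj G i j)
      ... | true  = trans (∧-identityʳ (adj G i j)) (independent i j i∈S (lookup⇒[]= j S j∈S))

      -- otherwise S ∪ ⁅ i ⁆ would be a larger independent set
      dominated : ∀ {i} → i ∉ S → 1 ≤ count (adjacentIn (lookup S) i)
      dominated {i} i∉S with count (adjacentIn (lookup S) i) in none
      ... | ℕ.suc _ = s≤s z≤n
      ... | ℕ.zero  = ⊥-elim (<⇒≱ (∣p∣<∣p∪⁅x⁆∣ i∉S) (maximum _ (independent-∪⁅⁆ independent i≁S)))
        where
          i≁S : ∀ j → j ∈ S → adj G i j ≡ false
          i≁S j j∈S = ∧-true⇒false (count≡0⇒false (adjacentIn (lookup S) i) none j) ([]=⇒lookup j∈S)

      row : ∀ i → Row (count (adjacentIn (lookup S) i)) (count (adj G i)) (lookup S i)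
      row i with lookup S i in i∈S
      ... | true  = subst (λ k → Row k (count (adj G i)) true)
                          (sym (false⇒count≡0 _ (isolated (lookup⇒[]= i S i∈S))))
                          (Row-true (count (adj G i)))
      ... | false = Row-false (dominated (lookup≡false⇒∉ i∈S))
                              (count-∧-≤ (adj G i) (lookup S))

independent? : (G : SimpleGraph n) → Decidable (IsIndependent G)
independent? G S = all? λ i → all? λ j → i ∈? S →-dec (j ∈? S →-dec adj G i j ≟ᵇ false)

∅-independent : (G : SimpleGraph n) → IsIndependent G ∅
∅-independent G i j i∈∅ _ = ⊥-elim (∉⊥ i∈∅)

dotOnes-toVec : (x : Fin n → Bool) → dotOnes (toVec x) ≡ + ∣ tabulate x ∣
dotOnes-toVec x = trans (∑-b2z x) (cong +_ (count≡∣tabulate∣ x))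

theorem4 : ∀ {n : ℕ} (G : SimpleGraph n) →
    Σ ℕ (λ α → IsIndependenceNumber G α × IsFeasibleMax G (+ α))
theorem4 G with largest (independent? G) (∅-independent G)
... | S , L@(independent , maximum) =
  ∣ S ∣ , ((S , independent , refl) , maximum) ,
  ((lookup S , largest-independent⇒feasible G L , value) , bound)
  where
    value : dotOnes (toVec (lookup S)) ≡ + ∣ S ∣
    value = trans (dotOnes-toVec (lookup S)) (cong (λ T → + ∣ T ∣) (tabulate∘lookup S))

    bound : ∀ x → Feasible G x → dotOnes (toVec x) ≤ℤ + ∣ S ∣
    bound x feasible = subst (_≤ℤ + ∣ S ∣) (sym (dotOnes-toVec x))
                             (+≤+ (maximum (tabulate x) (feasible⇒independent G feasible)))
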